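{- Let $p>q\geq 1$ be integers and let $u_\beta$ be the unique fixed point of the morphism $\varphi$ on $\{0,1\}^*$ given by $\varphi(0)=0^p1$, $\varphi(1)=0^q1$. Define $T:\{0,1\}^*\to\{0,1\}^*$ by $T(w)=0^q1\varphi(w)0^q$. Then: (1) for every $w\in\mathcal L(u_\beta)$, $T(w)\in\mathcal L(u_\beta)$; (2) for every factor $w$ of $u_\beta$ and letters $a,b\in\{0,1\}$, $awb\in\mathcal L(u_\beta)$ if and only if $aT(w)b\in\mathcal L(u_\beta)$; (3) for every bispecial factor $v$ of $u_\beta$ containing at least one letter $1$, there exists a unique factor $w$ such that $v=T(w)$; (4) for factors $w,v$ of $u_\beta$, $w$ is a prefix of $v$ if and only if $T(w)$ is a prefix of $T(v)$; (5) for factors $w,v$ of $u_\beta$, $w$ is a suffix of $v$ if and only if $T(w)$ is a suffix of $T(v)$.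
   Context: $\mathcal L(u)$ denotes the set of all (finite) factors of the infinite word $u$. The morphism $\varphi$ is extended to infinite words letter by letter; $u_\beta$ is its unique fixed point $\varphi(u_\beta)=u_\beta$ (it starts with $0^p1$). A factor $w$ of a binary word $u$ is left special if $0w,1w\in\mathcal L(u)$, right special if $w0,w1\in\mathcal L(u)$, and bispecial if both. -}

module Defs where

open import Data.Nat using (ℕ; zero; suc; _+_)
open import Data.List using (List; []; _∷_; _++_; replicate; concatMap; length)
open import Data.Product using (Σ; ∃; _×_; _,_)
open import Relation.Binary.PropositionalEquality using (_≡_)
open import Data.List.Membership.Propositional using (_∈_)

data Letter : Set where
  𝟎 𝟏 : Letter

Word : Set
Word = List Letter

InfWord : Set
InfWord = ℕ → Letter

φ-letter : ℕ → ℕ → Letter → Word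
φ-letter p q 𝟎 = replicate p 𝟎 ++ 𝟏 ∷ []
φ-letter p q 𝟏 = replicate q 𝟎 ++ 𝟏 ∷ []

φ : ℕ → ℕ → Word → Word
φ p q = concatMap (φ-letter p q)

iter : {A : Set} → ℕ → (A → A) → A → A
iter zero    f x = x
iter (suc k) f x = f (iter k f x)

-- n-th letter of a finite word (default 0 if out of range)
nth : Word → ℕ → Letter
nth []      n       = 𝟎
nth (a ∷ w) zero    = a
nth (a ∷ w) (suc n) = nth w n

-- the fixed point u_β: its n-th letter is the n-th letter of φ^(n+1)(0).
-- (For p > q ≥ 1, φ^k(0) is a prefix of φ^(k+1)(0) and |φ^(n+1)(0)| > n,
--  so this is the unique fixed point of φ starting with 0^p 1.)
uβ : ℕ → ℕ → InfWord
uβ p q n = nth (iter (suc n) (φ p q) (𝟎 ∷ [])) n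

window : InfWord → ℕ → ℕ → Word
window u i zero    = []
window u i (suc n) = u i ∷ window u (suc i) n

Factor : InfWord → Word → Set
Factor u w = Σ ℕ λ i → window u i (length w) ≡ w

LeftSpecial : InfWord → Word → Set
LeftSpecial u w = Factor u (𝟎 ∷ w) × Factor u (𝟏 ∷ w)

RightSpecial : InfWord → Word → Set
RightSpecial u w = Factor u (w ++ 𝟎 ∷ []) × Factor u (w ++ 𝟏 ∷ [])

Bispecial : InfWord → Word → Set
Bispecial u w = LeftSpecial u w × RightSpecial u w

T : ℕ → ℕ → Word → Word
T p q w = replicate q 𝟎 ++ 𝟏 ∷ (φ p q w ++ replicate q 𝟎)

IsPrefix : Word → Word → Set
IsPrefix w v = ∃ λ s → w ++ s ≡ v

IsSuffix : Word → Word → Set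
IsSuffix w v = ∃ λ s → s ++ w ≡ v

-- Since u = φ(u), every factor lies in some φ(z), and the letters 1 of φ(z) mark where the
-- images 0^p 1 and 0^q 1 of the letters of z end; as p ≠ q these blocks determine z. So an
-- occurrence of a T(w) b = a 0^q 1 φ(w) 0^q b in φ(z) can be desubstituted: φ(w) lies between
-- two block ends, b is the letter whose image begins with 0^q b, and a is read off the block
-- ending just before φ(w), since 0^p 1 ends with 0 0^q 1 while 0^q 1 is preceded by the 1 that
-- ends the previous block. Conversely φ(c a w b) contains a T(w) b, and every factor extends on
-- both sides; this gives (2), and then (1). A bispecial factor v containing 1 begins with 0^j 1
-- and ends with 1 0^j′, where j, j′ ∈ {p, q} because these runs of 0 sit between two 1's; as
-- neither 0^(p+1) 1 nor 1 0^(p+1) occurs, speciality forces j = j′ = q, so v = 0^q 1 φ(w) 0^q.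
-- Parts (4) and (5) hold for all words, by the injectivity of φ and desubstitution.
module Submission where

open import Defs
open import Data.Nat using (ℕ; zero; suc; _+_; _<_; _≤_; z≤n; s≤s)
open import Data.Nat.Properties
  using (+-comm; +-suc; +-identityʳ; ≤-trans; ≤-refl; m≤m+n; +-mono-≤; +-monoʳ-<; +-monoʳ-≤;
         <-irrefl; n<1+n; <⇒≢; <⇒≤; <-trans; <-≤-trans; m≤n⇒∃[o]m+o≡n; module ≤-Reasoning)
open import Data.List using ([]; _∷_; _++_; replicate; length; map; concat)
open import Data.List.Properties
  using (++-assoc; ++-cancelʳ; ++-cancelˡ; ++-conicalʳ; ∷ʳ-injective; length-++; ++-identityʳ;
         ++-monoid; ∷-injectiveˡ; ∷-injectiveʳ; map-++; concat-++)
open import Data.List.Membership.Propositional using (_∈_)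
open import Data.List.Membership.Propositional.Properties using (∈-++⁺ʳ)
open import Data.List.Relation.Unary.Any using (here; there)
open import Data.Product using (Σ; ∃; ∃₂; _×_; _,_; proj₁; proj₂)
open import Data.Sum using (_⊎_; inj₁; inj₂)
open import Data.Empty using (⊥-elim)
open import Relation.Nullary using (¬_)
open import Relation.Binary.PropositionalEquality
  using (_≡_; refl; sym; trans; cong; cong₂; subst; module ≡-Reasoning)
open import Function.Bundles using (_⇔_; mk⇔; Equivalence)
import Algebra.Solver.Monoid as MonoidSolver
open MonoidSolver (++-monoid Letter) using (solve; _⊜_; _⊕_)

zeros : ℕ → Word
zeros n = replicate n 𝟎

IsInfix : Word → Word → Set
IsInfix w z = ∃₂ λ x y → x ++ w ++ y ≡ z

IsPrefix⇒IsInfix : ∀ {w v} → IsPrefix w v → IsInfix w v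
IsPrefix⇒IsInfix (s , e) = [] , s , e

IsPrefix-++-∷ : ∀ x (b : Letter) r → IsPrefix (x ++ b ∷ []) (x ++ b ∷ r)
IsPrefix-++-∷ x b r = r , ++-assoc x (b ∷ []) r

IsSuffix⇒IsInfix : ∀ {w v} → IsSuffix w v → IsInfix w v
IsSuffix⇒IsInfix {w} (s , e) = s , [] , trans (cong (s ++_) (++-identityʳ w)) e

IsSuffix-++-∷ : ∀ r x (b : Letter) → IsSuffix (x ++ b ∷ []) ((r ++ x) ++ b ∷ [])
IsSuffix-++-∷ r x b = r , sym (++-assoc r x (b ∷ []))

IsInfix-trans : ∀ {u v w} → IsInfix u v → IsInfix v w → IsInfix u w
IsInfix-trans {u} (x , y , refl) (x′ , y′ , refl) = x′ ++ x , y ++ y′ ,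
  solve 5 (λ x′ x u y y′ → (x′ ⊕ x) ⊕ u ⊕ (y ⊕ y′) ⊜ x′ ⊕ (x ⊕ u ⊕ y) ⊕ y′) refl x′ x u y y′

∷≡++-∷-[] : ∀ (a : Letter) l → ∃₂ λ l′ c → a ∷ l ≡ l′ ++ c ∷ []
∷≡++-∷-[] a []      = [] , a , refl
∷≡++-∷-[] a (b ∷ l) with ∷≡++-∷-[] b l
... | l′ , c , e = a ∷ l′ , c , cong (a ∷_) e

++-∷≡∷ : ∀ y (b : Letter) r → ∃₂ λ d r′ → y ++ b ∷ r ≡ d ∷ r′
++-∷≡∷ []      b r = b , r , refl
++-∷≡∷ (d ∷ y) b r = d , y ++ b ∷ r , refl

IsInfix-strict-extend : ∀ {w z z′} a l b r → IsInfix w z → a ∷ l ++ z ++ b ∷ r ≡ z′ →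
                        ∃₂ λ c d → IsInfix (c ∷ w ++ d ∷ []) z′
IsInfix-strict-extend {w} a l b r (x , y , refl) refl
  with ∷≡++-∷-[] a (l ++ x) | ++-∷≡∷ y b r
... | l′ , c , eL | d , r′ , eR = c , d , l′ , r′ , (begin
  l′ ++ (c ∷ w ++ d ∷ []) ++ r′   ≡⟨ solve 5 (λ l′ c w d r′ → l′ ⊕ (c ⊕ w ⊕ d) ⊕ r′ ⊜ (l′ ⊕ c) ⊕ w ⊕ (d ⊕ r′))
                                            refl l′ (c ∷ []) w (d ∷ []) r′ ⟩
  (l′ ++ c ∷ []) ++ w ++ d ∷ r′   ≡⟨ cong₂ (λ L R → L ++ w ++ R) (sym eL) (sym eR) ⟩
  a ∷ (l ++ x) ++ w ++ y ++ b ∷ r ≡⟨ cong (a ∷_) (solve 5 (λ l x w y br → (l ⊕ x) ⊕ w ⊕ (y ⊕ br) ⊜ l ⊕ (x ⊕ w ⊕ y) ⊕ br)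
                                                      refl l x w y (b ∷ r)) ⟩
  a ∷ l ++ (x ++ w ++ y) ++ b ∷ r ∎)
  where open ≡-Reasoning

zeros-+ : ∀ m n → zeros (m + n) ≡ zeros m ++ zeros n
zeros-+ zero    n = refl
zeros-+ (suc m) n = cong (𝟎 ∷_) (zeros-+ m n)

𝟏∉zeros : ∀ n → ¬ 𝟏 ∈ zeros n
𝟏∉zeros zero    ()
𝟏∉zeros (suc n) (there 𝟏∈) = 𝟏∉zeros n 𝟏∈

𝟏-lies-before-zeros : ∀ s x y n → s ++ 𝟏 ∷ x ≡ y ++ zeros n → ∃ λ t → s ++ 𝟏 ∷ t ≡ y
𝟏-lies-before-zeros s x [] n e = ⊥-elim (𝟏∉zeros n (subst (𝟏 ∈_) e (∈-++⁺ʳ s (here refl))))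
𝟏-lies-before-zeros [] x (b ∷ y) n e with ∷-injectiveˡ e
... | refl = y , refl
𝟏-lies-before-zeros (a ∷ s) x (b ∷ y) n e with ∷-injectiveˡ e | 𝟏-lies-before-zeros s x y n (∷-injectiveʳ e)
... | refl | t , e′ = t , cong (a ∷_) e′

block-injective : ∀ m n s t → zeros m ++ 𝟏 ∷ s ≡ zeros n ++ 𝟏 ∷ t → m ≡ n × s ≡ t
block-injective zero    zero    s t refl = refl , refl
block-injective (suc m) (suc n) s t e with block-injective m n s t (∷-injectiveʳ e)
... | refl , e′ = refl , e′

block≡zeros-𝟎⇒< : ∀ m n s t → zeros m ++ 𝟏 ∷ s ≡ zeros n ++ 𝟎 ∷ t → n < m
block≡zeros-𝟎⇒< (suc m) zero    s t e = s≤s z≤n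
block≡zeros-𝟎⇒< (suc m) (suc n) s t e = s≤s (block≡zeros-𝟎⇒< m n s t (∷-injectiveʳ e))

block-split : ∀ n r x y → zeros n ++ 𝟏 ∷ r ≡ x ++ 𝟏 ∷ y →
              (x ≡ zeros n × r ≡ y) ⊎ ∃ λ x′ → x ≡ zeros n ++ 𝟏 ∷ x′ × x′ ++ 𝟏 ∷ y ≡ r
block-split zero    r []      y refl = inj₁ (refl , refl)
block-split zero    r (𝟏 ∷ x) y refl = inj₂ (x , refl , refl)
block-split (suc n) r (𝟎 ∷ x) y e with block-split n r x y (∷-injectiveʳ e)
... | inj₁ (e₁ , e₂)      = inj₁ (cong (𝟎 ∷_) e₁ , e₂)
... | inj₂ (x′ , e₁ , e₂) = inj₂ (x′ , cong (𝟎 ∷_) e₁ , e₂)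

first-𝟏 : ∀ v → 𝟏 ∈ v → ∃₂ λ j r → v ≡ zeros j ++ 𝟏 ∷ r
first-𝟏 (𝟏 ∷ v) _ = 0 , v , refl
first-𝟏 (𝟎 ∷ v) (there 𝟏∈) with first-𝟏 v 𝟏∈
... | j , r , e = suc j , r , cong (𝟎 ∷_) e

last-𝟏-or-zeros : ∀ v → (∃₂ λ r j → v ≡ r ++ 𝟏 ∷ zeros j) ⊎ v ≡ zeros (length v)
last-𝟏-or-zeros []      = inj₂ refl
last-𝟏-or-zeros (a ∷ v) with last-𝟏-or-zeros v
... | inj₁ (r , j , e) = inj₁ (a ∷ r , j , cong (a ∷_) e)
last-𝟏-or-zeros (𝟏 ∷ v) | inj₂ e = inj₁ ([] , length v , cong (𝟏 ∷_) e)
last-𝟏-or-zeros (𝟎 ∷ v) | inj₂ e = inj₂ (cong (𝟎 ∷_) e)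

last-𝟏 : ∀ v → 𝟏 ∈ v → ∃₂ λ r j → v ≡ r ++ 𝟏 ∷ zeros j
last-𝟏 v 𝟏∈ with last-𝟏-or-zeros v
... | inj₁ found = found
... | inj₂ e     = ⊥-elim (𝟏∉zeros (length v) (subst (𝟏 ∈_) e 𝟏∈))

nth-++ˡ : ∀ l s n → n < length l → nth (l ++ s) n ≡ nth l n
nth-++ˡ (a ∷ l) s zero    _         = refl
nth-++ˡ (a ∷ l) s (suc n) (s≤s n<) = nth-++ˡ l s n n<

nth-++ʳ : ∀ x l j → nth (x ++ l) (length x + j) ≡ nth l j
nth-++ʳ []      l j = refl
nth-++ʳ (a ∷ x) l j = nth-++ʳ x l j

nth-IsPrefix : ∀ {l l′} n → IsPrefix l l′ → n < length l → nth l′ n ≡ nth l n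
nth-IsPrefix {l} n (s , refl) = nth-++ˡ l s n

window-cong : ∀ u v i n → (∀ j → j < i + n → u j ≡ v j) → window u i n ≡ window v i n
window-cong u v i zero    h = refl
window-cong u v i (suc n) h rewrite +-suc i n =
  cong₂ _∷_ (h i (s≤s (m≤m+n i n))) (window-cong u v (suc i) n h)

window-suc : ∀ u i n → window u (suc i) n ≡ window (λ j → u (suc j)) i n
window-suc u i zero    = refl
window-suc u i (suc n) = cong (u (suc i) ∷_) (window-suc u (suc i) n)

window-≡ : ∀ u i l → (∀ j → j < length l → u (i + j) ≡ nth l j) → window u i (length l) ≡ l
window-≡ u i []      h = refl
window-≡ u i (a ∷ l) h =
  cong₂ _∷_ (trans (cong u (sym (+-identityʳ i))) (h 0 (s≤s z≤n)))
            (window-≡ u (suc i) l (λ j j< → trans (cong u (sym (+-suc i j))) (h (suc j) (s≤s j<))))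

window-nth-IsPrefix : ∀ l n → n ≤ length l → IsPrefix (window (nth l) 0 n) l
window-nth-IsPrefix l       zero    _        = l , refl
window-nth-IsPrefix (a ∷ l) (suc n) (s≤s n≤) with window-nth-IsPrefix l n n≤
... | y , e = y , cong (a ∷_) (trans (cong (_++ y) (window-suc (nth (a ∷ l)) 0 n)) e)

window-nth-IsInfix : ∀ l i n → i + n ≤ length l → IsInfix (window (nth l) i n) l
window-nth-IsInfix l       zero    n n≤ = IsPrefix⇒IsInfix (window-nth-IsPrefix l n n≤)
window-nth-IsInfix (a ∷ l) (suc i) n (s≤s i+n≤) with window-nth-IsInfix l i n i+n≤
... | x , y , e = a ∷ x , y ,
  cong (a ∷_) (trans (cong (λ t → x ++ t ++ y) (window-suc (nth (a ∷ l)) i n)) e)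

module Desubstitution (p q : ℕ) where

  blockLength : Letter → ℕ
  blockLength 𝟎 = p
  blockLength 𝟏 = q

  φ-letter≡block : ∀ c → φ-letter p q c ≡ zeros (blockLength c) ++ 𝟏 ∷ []
  φ-letter≡block 𝟎 = refl
  φ-letter≡block 𝟏 = refl

  φ-∷ : ∀ c w → φ p q (c ∷ w) ≡ zeros (blockLength c) ++ 𝟏 ∷ φ p q w
  φ-∷ c w = trans (cong (_++ φ p q w) (φ-letter≡block c)) (++-assoc (zeros (blockLength c)) (𝟏 ∷ []) (φ p q w))

  φ-∷-++ : ∀ c w y → φ p q (c ∷ w) ++ y ≡ zeros (blockLength c) ++ 𝟏 ∷ (φ p q w ++ y)
  φ-∷-++ c w y = trans (cong (_++ y) (φ-∷ c w)) (++-assoc (zeros (blockLength c)) (𝟏 ∷ φ p q w) y)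

  φ-++ : ∀ u v → φ p q (u ++ v) ≡ φ p q u ++ φ p q v
  φ-++ u v = trans (cong concat (map-++ (φ-letter p q) u v)) (sym (concat-++ (map (φ-letter p q) u) _))

  φ-IsPrefix : ∀ {w v} → IsPrefix w v → IsPrefix (φ p q w) (φ p q v)
  φ-IsPrefix {w} (s , refl) = φ p q s , sym (φ-++ w s)

  φ-IsInfix : ∀ {w v} → IsInfix w v → IsInfix (φ p q w) (φ p q v)
  φ-IsInfix {w} (x , y , refl) = φ p q x , φ p q y , sym (trans (φ-++ x (w ++ y)) (cong (φ p q x ++_) (φ-++ w y)))

  φ-split-at-𝟏 : ∀ z x y → x ++ 𝟏 ∷ y ≡ φ p q z → ∃₂ λ z₁ c → ∃ λ z₂ →
                 z ≡ z₁ ++ c ∷ z₂ × x ≡ φ p q z₁ ++ zeros (blockLength c) × y ≡ φ p q z₂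
  φ-split-at-𝟏 [] x y e with ++-conicalʳ x _ e
  ... | ()
  φ-split-at-𝟏 (c ∷ z) x y e with block-split (blockLength c) (φ p q z) x y (trans (sym (φ-∷ c z)) (sym e))
  ... | inj₁ (ex , ey) = [] , c , z , refl , ex , sym ey
  ... | inj₂ (x′ , ex , ey) with φ-split-at-𝟏 z x′ y ey
  ...   | z₁ , c′ , z₂ , refl , refl , ey′ = c ∷ z₁ , c′ , z₂ , refl ,
          trans ex (trans (sym (++-assoc (zeros (blockLength c)) (𝟏 ∷ φ p q z₁) _))
                          (cong (_++ zeros (blockLength c′)) (sym (φ-∷ c z₁)))) , ey′

  block-before-𝟏 : ∀ z j s → zeros j ++ 𝟏 ∷ s ≡ φ p q z → ∃ λ d → j ≡ blockLength d
  block-before-𝟏 []      j s e with ++-conicalʳ (zeros j) _ e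
  ... | ()
  block-before-𝟏 (d ∷ z) j s e = d , proj₁ (block-injective j (blockLength d) s _ (trans e (φ-∷ d z)))

  zeros-between-𝟏s : ∀ z j → IsInfix (𝟏 ∷ zeros j ++ 𝟏 ∷ []) (φ p q z) → ∃ λ d → j ≡ blockLength d
  zeros-between-𝟏s z j (x , y , e)
    with φ-split-at-𝟏 z x (zeros j ++ 𝟏 ∷ y) (trans (cong (λ t → x ++ 𝟏 ∷ t) (sym (++-assoc (zeros j) (𝟏 ∷ []) y))) e)
  ... | _ , _ , z₂ , _ , _ , ey = block-before-𝟏 z₂ j y ey

  φ-between-𝟏s : ∀ z m → IsInfix (𝟏 ∷ m ++ 𝟏 ∷ []) (φ p q z) → ∃ λ w → IsInfix w z × φ p q w ≡ m ++ 𝟏 ∷ []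
  φ-between-𝟏s z m (x , y , e)
    with φ-split-at-𝟏 z x (m ++ 𝟏 ∷ y) (trans (cong (λ t → x ++ 𝟏 ∷ t) (sym (++-assoc m (𝟏 ∷ []) y))) e)
  ... | z₁ , c , z₂ , refl , _ , ey with φ-split-at-𝟏 z₂ m y ey
  ...   | z₁′ , c′ , z₃ , refl , refl , _ = z₁′ ++ c′ ∷ [] , (z₁ ++ c ∷ [] , z₃ , regroup) , φ-z₁′c′
    where
    regroup : (z₁ ++ c ∷ []) ++ (z₁′ ++ c′ ∷ []) ++ z₃ ≡ z₁ ++ c ∷ z₁′ ++ c′ ∷ z₃
    regroup = solve 5 (λ z₁ c z₁′ c′ z₃ → (z₁ ⊕ c) ⊕ (z₁′ ⊕ c′) ⊕ z₃ ⊜ z₁ ⊕ c ⊕ (z₁′ ⊕ c′ ⊕ z₃))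
                      refl z₁ (c ∷ []) z₁′ (c′ ∷ []) z₃
    φ-z₁′c′ : φ p q (z₁′ ++ c′ ∷ []) ≡ (φ p q z₁′ ++ zeros (blockLength c′)) ++ 𝟏 ∷ []
    φ-z₁′c′ = begin
      φ p q (z₁′ ++ c′ ∷ [])                          ≡⟨ φ-++ z₁′ (c′ ∷ []) ⟩
      φ p q z₁′ ++ φ-letter p q c′ ++ []               ≡⟨ cong (φ p q z₁′ ++_) (trans (++-identityʳ _) (φ-letter≡block c′)) ⟩
      φ p q z₁′ ++ zeros (blockLength c′) ++ 𝟏 ∷ []    ≡⟨ sym (++-assoc (φ p q z₁′) _ _) ⟩
      (φ p q z₁′ ++ zeros (blockLength c′)) ++ 𝟏 ∷ [] ∎
      where open ≡-Reasoning

  zeros-before-𝟎 : ∀ z j y → zeros j ++ 𝟎 ∷ y ≡ φ p q z → ∃ λ d → j < blockLength d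
  zeros-before-𝟎 []      j y e with ++-conicalʳ (zeros j) _ e
  ... | ()
  zeros-before-𝟎 (d ∷ z) j y e = d , block≡zeros-𝟎⇒< (blockLength d) j _ y (sym (trans e (φ-∷ d z)))

  zeros-after-𝟏 : ∀ z j → IsInfix (𝟏 ∷ zeros j ++ 𝟎 ∷ []) (φ p q z) → ∃ λ d → j < blockLength d
  zeros-after-𝟏 z j (x , y , e)
    with φ-split-at-𝟏 z x (zeros j ++ 𝟎 ∷ y) (trans (cong (λ t → x ++ 𝟏 ∷ t) (sym (++-assoc (zeros j) (𝟎 ∷ []) y))) e)
  ... | _ , _ , z₂ , _ , _ , ey = zeros-before-𝟎 z₂ j y ey

-- Writing q = 1 + q′ and p = 1 + q + k makes the hypotheses p > q ≥ 1 hold definitionally.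
module FixedPoint (q′ k : ℕ) where

  q p : ℕ
  q = suc q′
  p = suc (q + k)

  open Desubstitution p q

  Φ : Word → Word
  Φ = φ p q

  u : InfWord
  u = uβ p q

  q<p : q < p
  q<p = s≤s (m≤m+n q k)

  blockLength≤p : ∀ c → blockLength c ≤ p
  blockLength≤p 𝟎 = ≤-refl
  blockLength≤p 𝟏 = <⇒≤ q<p

  blockLength-injective : ∀ c d → blockLength c ≡ blockLength d → c ≡ d
  blockLength-injective 𝟎 𝟎 _ = refl
  blockLength-injective 𝟏 𝟏 _ = refl
  blockLength-injective 𝟎 𝟏 e = ⊥-elim (<⇒≢ q<p (sym e))
  blockLength-injective 𝟏 𝟎 e = ⊥-elim (<⇒≢ q<p e)

  zeros-p≡zeros-k-𝟎-zeros-q : zeros p ≡ zeros k ++ 𝟎 ∷ zeros q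
  zeros-p≡zeros-k-𝟎-zeros-q = trans (cong zeros (trans (cong suc (+-comm q k)) (sym (+-suc k q)))) (zeros-+ k (suc q))

  zeros-p≡zeros-q-𝟎-zeros-k : zeros p ≡ zeros q ++ 𝟎 ∷ zeros k
  zeros-p≡zeros-q-𝟎-zeros-k = trans (cong zeros (sym (+-suc q k))) (zeros-+ q (suc k))

  φ-prefix-cancel : ∀ w z y → Φ w ++ y ≡ Φ z → ∃ λ z₂ → z ≡ w ++ z₂ × y ≡ Φ z₂
  φ-prefix-cancel []      z       y e = z , refl , e
  φ-prefix-cancel (c ∷ w) []      y e with ++-conicalʳ (zeros (blockLength c)) _ (trans (sym (φ-∷-++ c w y)) e)
  ... | ()
  φ-prefix-cancel (c ∷ w) (d ∷ z) y e
    with block-injective (blockLength c) (blockLength d) (Φ w ++ y) (Φ z) (trans (sym (φ-∷-++ c w y)) (trans e (φ-∷ d z)))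
  ... | c≡d , e′ with blockLength-injective c d c≡d | φ-prefix-cancel w z y e′
  ...   | refl | z₂ , refl , ey = z₂ , refl , ey

  φ-injective : ∀ w v → Φ w ≡ Φ v → w ≡ v
  φ-injective w v e with φ-prefix-cancel w v [] (trans (++-identityʳ (Φ w)) e)
  ... | []    , ev , _  = sym (trans ev (++-identityʳ w))
  ... | d ∷ z , _  , e₀ with ++-conicalʳ (zeros (blockLength d)) _ (sym (trans e₀ (φ-∷ d z)))
  ...   | ()

  T-injective : ∀ w v → T p q w ≡ T p q v → w ≡ v
  T-injective w v e = φ-injective w v (++-cancelʳ (zeros q) (Φ w) (Φ v) (∷-injectiveʳ (++-cancelˡ (zeros q) _ _ e)))

  φ-letter-starts : ∀ b → ∃ λ R → φ-letter p q b ≡ zeros q ++ b ∷ R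
  φ-letter-starts 𝟏 = [] , refl
  φ-letter-starts 𝟎 = zeros k ++ 𝟏 ∷ [] ,
    trans (cong (_++ 𝟏 ∷ []) zeros-p≡zeros-q-𝟎-zeros-k) (++-assoc (zeros q) (𝟎 ∷ zeros k) (𝟏 ∷ []))

  φ-letter-ends : ∀ c → ∃ λ X → φ-letter p q c ≡ X ++ zeros q ++ 𝟏 ∷ []
  φ-letter-ends 𝟏 = [] , refl
  φ-letter-ends 𝟎 = zeros k ++ 𝟎 ∷ [] ,
    trans (cong (_++ 𝟏 ∷ []) zeros-p≡zeros-k-𝟎-zeros-q)
          (solve 4 (λ Zk o Zq i → (Zk ⊕ o ⊕ Zq) ⊕ i ⊜ (Zk ⊕ o) ⊕ Zq ⊕ i) refl (zeros k) (𝟎 ∷ []) (zeros q) (𝟏 ∷ []))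

  φ-∷-ends : ∀ c z → ∃ λ s → Φ (c ∷ z) ≡ s ++ zeros q ++ 𝟏 ∷ []
  φ-∷-ends c [] with φ-letter-ends c
  ... | X , e = X , trans (++-identityʳ _) e
  φ-∷-ends c (d ∷ z) with φ-∷-ends d z
  ... | s , e = φ-letter p q c ++ s , trans (cong (φ-letter p q c ++_) e) (sym (++-assoc (φ-letter p q c) s _))

  φ-∷-ends-𝟏 : ∀ c z → ∃ λ s → Φ (c ∷ z) ≡ s ++ 𝟏 ∷ []
  φ-∷-ends-𝟏 c z with φ-∷-ends c z
  ... | s , e = s ++ zeros q , trans e (sym (++-assoc s (zeros q) (𝟏 ∷ [])))

  φ-last : ∀ z x a → x ++ a ∷ [] ≡ Φ z → a ≡ 𝟏
  φ-last []      x a e with ++-conicalʳ x _ e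
  ... | ()
  φ-last (c ∷ z) x a e with φ-∷-ends-𝟏 c z
  ... | s , es = proj₂ (∷ʳ-injective x s (trans e es))

  𝟎-zeros-p≢φ-++-block : ∀ x z c → ¬ (x ++ 𝟎 ∷ zeros p ≡ Φ z ++ zeros (blockLength c))
  𝟎-zeros-p≢φ-++-block x z 𝟎 e
    with φ-last z x 𝟎 (++-cancelʳ (zeros p) (x ++ 𝟎 ∷ []) (Φ z) (trans (++-assoc x (𝟎 ∷ []) (zeros p)) e))
  ... | ()
  𝟎-zeros-p≢φ-++-block x z 𝟏 e
    with φ-last z (x ++ 𝟎 ∷ zeros k) 𝟎 (++-cancelʳ (zeros q) _ (Φ z) (trans regroup e))
    where
    regroup : ((x ++ 𝟎 ∷ zeros k) ++ 𝟎 ∷ []) ++ zeros q ≡ x ++ 𝟎 ∷ zeros p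
    regroup = trans (solve 5 (λ x o Zk o′ Zq → ((x ⊕ o ⊕ Zk) ⊕ o′) ⊕ Zq ⊜ x ⊕ o ⊕ (Zk ⊕ o′ ⊕ Zq))
                             refl x (𝟎 ∷ []) (zeros k) (𝟎 ∷ []) (zeros q))
                    (cong (λ t → x ++ 𝟎 ∷ t) (sym zeros-p≡zeros-k-𝟎-zeros-q))
  ... | ()

  no-long-zero-run : ∀ z → ¬ IsInfix (𝟎 ∷ zeros p ++ 𝟏 ∷ []) (Φ z)
  no-long-zero-run z (x , y , e)
    with φ-split-at-𝟏 z (x ++ 𝟎 ∷ zeros p) y
           (trans (solve 5 (λ x o Zp i y → (x ⊕ o ⊕ Zp) ⊕ i ⊕ y ⊜ x ⊕ (o ⊕ Zp ⊕ i) ⊕ y) refl x (𝟎 ∷ []) (zeros p) (𝟏 ∷ []) y) e)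
  ... | z₁ , c , _ , _ , ex , _ = 𝟎-zeros-p≢φ-++-block x z₁ c ex

  φ-letter-pair-ends : ∀ c a → ∃ λ X → φ-letter p q c ++ φ-letter p q a ≡ X ++ a ∷ zeros q ++ 𝟏 ∷ []
  φ-letter-pair-ends c 𝟎 = φ-letter p q c ++ zeros k ,
    trans (cong (λ t → φ-letter p q c ++ t ++ 𝟏 ∷ []) zeros-p≡zeros-k-𝟎-zeros-q)
          (solve 5 (λ f Zk o Zq i → f ⊕ ((Zk ⊕ o ⊕ Zq) ⊕ i) ⊜ (f ⊕ Zk) ⊕ o ⊕ Zq ⊕ i)
                   refl (φ-letter p q c) (zeros k) (𝟎 ∷ []) (zeros q) (𝟏 ∷ []))
  φ-letter-pair-ends c 𝟏 = zeros (blockLength c) ,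
    trans (cong (_++ zeros q ++ 𝟏 ∷ []) (φ-letter≡block c)) (++-assoc (zeros (blockLength c)) (𝟏 ∷ []) _)

  T-IsInfix-φ : ∀ c a w b → IsInfix (a ∷ T p q w ++ b ∷ []) (Φ (c ∷ a ∷ w ++ b ∷ []))
  T-IsInfix-φ c a w b with φ-letter-pair-ends c a | φ-letter-starts b
  ... | X , eX | R , eR = X , R , (begin
    X ++ (a ∷ T p q w ++ b ∷ []) ++ R
      ≡⟨ solve 7 (λ X a Zq i Φw b R → X ⊕ (a ⊕ (Zq ⊕ i ⊕ (Φw ⊕ Zq)) ⊕ b) ⊕ R ⊜ (X ⊕ a ⊕ Zq ⊕ i) ⊕ Φw ⊕ (Zq ⊕ b ⊕ R))
                 refl X (a ∷ []) (zeros q) (𝟏 ∷ []) (Φ w) (b ∷ []) R ⟩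
    (X ++ a ∷ zeros q ++ 𝟏 ∷ []) ++ Φ w ++ zeros q ++ b ∷ R
      ≡⟨ cong₂ (λ A B → A ++ Φ w ++ B) (sym eX) (sym eR) ⟩
    (φ-letter p q c ++ φ-letter p q a) ++ Φ w ++ φ-letter p q b
      ≡⟨ solve 4 (λ c a w b → (c ⊕ a) ⊕ w ⊕ b ⊜ c ⊕ a ⊕ w ⊕ b) refl (φ-letter p q c) (φ-letter p q a) (Φ w) (φ-letter p q b) ⟩
    φ-letter p q c ++ φ-letter p q a ++ Φ w ++ φ-letter p q b
      ≡⟨ cong (λ t → φ-letter p q c ++ φ-letter p q a ++ t) (sym (trans (φ-++ w (b ∷ [])) (cong (Φ w ++_) (++-identityʳ _)))) ⟩
    Φ (c ∷ a ∷ w ++ b ∷ []) ∎)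
    where open ≡-Reasoning

  letter-after-zeros-q : ∀ z b y → zeros q ++ b ∷ y ≡ Φ z → ∃ λ z′ → z ≡ b ∷ z′
  letter-after-zeros-q (c ∷ z) b y e with φ-letter-starts c
  ... | R , eR with ∷-injectiveˡ (++-cancelˡ (zeros q) _ _ (trans e (trans (cong (_++ Φ z) eR) (++-assoc (zeros q) _ (Φ z)))))
  ...   | refl = z , refl

  letter-before-zeros-q : ∀ x a z c → x ++ a ∷ zeros q ≡ Φ z ++ zeros (blockLength c) → a ≡ c
  letter-before-zeros-q x a z 𝟏 e =
    φ-last z x a (++-cancelʳ (zeros q) (x ++ a ∷ []) (Φ z) (trans (++-assoc x (a ∷ []) (zeros q)) e))
  letter-before-zeros-q x a z 𝟎 e = proj₂ (∷ʳ-injective x (Φ z ++ zeros k)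
    (++-cancelʳ (zeros q) (x ++ a ∷ []) ((Φ z ++ zeros k) ++ 𝟎 ∷ [])
      (trans (++-assoc x (a ∷ []) (zeros q)) (trans e (trans (cong (Φ z ++_) zeros-p≡zeros-k-𝟎-zeros-q)
        (solve 4 (λ Φz Zk o Zq → Φz ⊕ (Zk ⊕ o ⊕ Zq) ⊜ ((Φz ⊕ Zk) ⊕ o) ⊕ Zq) refl (Φ z) (zeros k) (𝟎 ∷ []) (zeros q)))))))

  T-desubstitution : ∀ z a w b → IsInfix (a ∷ T p q w ++ b ∷ []) (Φ z) → IsInfix (a ∷ w ++ b ∷ []) z
  T-desubstitution z a w b (x , y , e)
    with φ-split-at-𝟏 z (x ++ a ∷ zeros q) (Φ w ++ zeros q ++ b ∷ y)
           (trans (solve 7 (λ x a Zq i Φw b y → (x ⊕ a ⊕ Zq) ⊕ i ⊕ (Φw ⊕ Zq ⊕ b ⊕ y) ⊜ x ⊕ (a ⊕ (Zq ⊕ i ⊕ (Φw ⊕ Zq)) ⊕ b) ⊕ y)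
                           refl x (a ∷ []) (zeros q) (𝟏 ∷ []) (Φ w) (b ∷ []) y) e)
  ... | z₁ , c , z₂ , refl , ex , ey with φ-prefix-cancel w z₂ (zeros q ++ b ∷ y) ey
  ...   | z₃ , refl , ey′ with letter-after-zeros-q z₃ b y ey′ | letter-before-zeros-q x a z₁ c ex
  ...     | z₄ , refl | refl = z₁ , z₄ ,
    solve 5 (λ z₁ a w b z₄ → z₁ ⊕ (a ⊕ w ⊕ b) ⊕ z₄ ⊜ z₁ ⊕ a ⊕ w ⊕ b ⊕ z₄) refl z₁ (a ∷ []) w (b ∷ []) z₄

  φⁿ𝟎 : ℕ → Word
  φⁿ𝟎 n = iter n Φ (𝟎 ∷ [])

  φⁿ𝟎-IsPrefix-suc : ∀ n → IsPrefix (φⁿ𝟎 n) (φⁿ𝟎 (suc n))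
  φⁿ𝟎-IsPrefix-suc zero    = (zeros (q + k) ++ 𝟏 ∷ []) ++ [] , refl
  φⁿ𝟎-IsPrefix-suc (suc n) = φ-IsPrefix (φⁿ𝟎-IsPrefix-suc n)

  φⁿ𝟎-IsPrefix-+ : ∀ m d → IsPrefix (φⁿ𝟎 m) (φⁿ𝟎 (d + m))
  φⁿ𝟎-IsPrefix-+ m zero    = [] , ++-identityʳ (φⁿ𝟎 m)
  φⁿ𝟎-IsPrefix-+ m (suc d) with φⁿ𝟎-IsPrefix-+ m d | φⁿ𝟎-IsPrefix-suc (d + m)
  ... | s , e | s′ , e′ = s ++ s′ , trans (sym (++-assoc (φⁿ𝟎 m) s s′)) (trans (cong (_++ s′) e) e′)

  φⁿ𝟎-head : ∀ n → ∃ λ t → φⁿ𝟎 n ≡ 𝟎 ∷ t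
  φⁿ𝟎-head zero = [] , refl
  φⁿ𝟎-head (suc n) with φⁿ𝟎-head n | φⁿ𝟎-IsPrefix-suc n
  ... | t , e | s , e′ = t ++ s , trans (sym e′) (cong (_++ s) e)

  -- Needs p ≥ 2: φ(0) = 0 0 0^(p-2) 1.
  φⁿ𝟎-square : ∀ n → ∃ λ r → φⁿ𝟎 n ++ φⁿ𝟎 n ++ r ≡ φⁿ𝟎 (suc n)
  φⁿ𝟎-square zero = (zeros (q′ + k) ++ 𝟏 ∷ []) ++ [] , refl
  φⁿ𝟎-square (suc n) with φⁿ𝟎-square n
  ... | r , e = Φ r , trans (sym (trans (φ-++ (φⁿ𝟎 n) _) (cong (Φ (φⁿ𝟎 n) ++_) (φ-++ (φⁿ𝟎 n) r)))) (cong Φ e)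

  φⁿ𝟎-length : ∀ n → n < length (φⁿ𝟎 n)
  φⁿ𝟎-length zero = s≤s z≤n
  φⁿ𝟎-length (suc n) with φⁿ𝟎-square n
  ... | r , e = begin-strict
    suc n                                       <⟨ +-mono-≤ (≤-trans (s≤s z≤n) ih) ih ⟩
    ℓ + ℓ                                       ≤⟨ +-monoʳ-≤ ℓ (m≤m+n ℓ (length r)) ⟩
    ℓ + (ℓ + length r)                          ≡⟨ sym (trans (length-++ (φⁿ𝟎 n)) (cong (ℓ +_) (length-++ (φⁿ𝟎 n)))) ⟩
    length (φⁿ𝟎 n ++ φⁿ𝟎 n ++ r)                ≡⟨ cong length e ⟩
    length (φⁿ𝟎 (suc n))                        ∎
    where
    open ≤-Reasoning
    ℓ : ℕ
    ℓ = length (φⁿ𝟎 n)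
    ih : n < ℓ
    ih = φⁿ𝟎-length n

  φⁿ𝟎-inner : ∀ n → ∃₂ λ l r → 𝟎 ∷ l ++ φⁿ𝟎 n ++ 𝟎 ∷ r ≡ φⁿ𝟎 (suc (suc n))
  φⁿ𝟎-inner n with φⁿ𝟎-square n | φⁿ𝟎-square (suc n) | φⁿ𝟎-head n | φⁿ𝟎-head (suc n)
  ... | r , e | r′ , e′ | t , et | t′ , et′ = t′ , t ++ r ++ r′ , (begin
    𝟎 ∷ t′ ++ P ++ 𝟎 ∷ t ++ r ++ r′             ≡⟨ cong (𝟎 ∷_) (solve 5 (λ t′ P t r r′ → t′ ⊕ P ⊕ (t ⊕ r ⊕ r′) ⊜ t′ ⊕ (P ⊕ t ⊕ r) ⊕ r′)
                                                                      refl t′ P (𝟎 ∷ t) r r′) ⟩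
    (𝟎 ∷ t′) ++ (P ++ (𝟎 ∷ t) ++ r) ++ r′       ≡⟨ cong₂ (λ A B → A ++ (P ++ B ++ r) ++ r′) (sym et′) (sym et) ⟩
    φⁿ𝟎 (suc n) ++ (P ++ P ++ r) ++ r′          ≡⟨ cong (λ A → φⁿ𝟎 (suc n) ++ A ++ r′) e ⟩
    φⁿ𝟎 (suc n) ++ φⁿ𝟎 (suc n) ++ r′            ≡⟨ e′ ⟩
    φⁿ𝟎 (suc (suc n))                           ∎)
    where
    open ≡-Reasoning
    P : Word
    P = φⁿ𝟎 n

  uβ≡nth-φⁿ𝟎 : ∀ m n → n < length (φⁿ𝟎 m) → u n ≡ nth (φⁿ𝟎 m) n
  uβ≡nth-φⁿ𝟎 m n n< = begin
    nth (φⁿ𝟎 (suc n)) n          ≡⟨ sym (nth-IsPrefix n (φⁿ𝟎-IsPrefix-+ (suc n) m) (<-trans (n<1+n n) (φⁿ𝟎-length (suc n)))) ⟩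
    nth (φⁿ𝟎 (m + suc n)) n      ≡⟨ cong (λ i → nth (φⁿ𝟎 i) n) (+-comm m (suc n)) ⟩
    nth (φⁿ𝟎 (suc n + m)) n      ≡⟨ nth-IsPrefix n (φⁿ𝟎-IsPrefix-+ m (suc n)) n< ⟩
    nth (φⁿ𝟎 m) n                ∎
    where open ≡-Reasoning

  IsInfix⇒Factor : ∀ n w → IsInfix w (φⁿ𝟎 n) → Factor u w
  IsInfix⇒Factor n w (x , y , e) = length x , window-≡ u (length x) w letters
    where
    letters : ∀ j → j < length w → u (length x + j) ≡ nth w j
    letters j j< = begin
      u (length x + j)                    ≡⟨ uβ≡nth-φⁿ𝟎 n (length x + j) (subst (λ l → length x + j < length l) e in-range) ⟩
      nth (φⁿ𝟎 n) (length x + j)          ≡⟨ cong (λ l → nth l (length x + j)) (sym e) ⟩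
      nth (x ++ w ++ y) (length x + j)    ≡⟨ nth-++ʳ x (w ++ y) j ⟩
      nth (w ++ y) j                      ≡⟨ nth-++ˡ w y j j< ⟩
      nth w j                             ∎
      where
      open ≡-Reasoning
      in-range : length x + j < length (x ++ w ++ y)
      in-range = subst (length x + j <_) (sym (trans (length-++ x) (cong (length x +_) (length-++ w))))
                       (<-≤-trans (+-monoʳ-< (length x) j<) (+-monoʳ-≤ (length x) (m≤m+n (length w) (length y))))

  Factor⇒IsInfix : ∀ w → Factor u w → ∃ λ n → IsInfix w (φⁿ𝟎 n)
  Factor⇒IsInfix w (i , e) =
    let x , y , e′ = window-nth-IsInfix (φⁿ𝟎 N) i (length w) (<⇒≤ (φⁿ𝟎-length N))
    in N , x , y , trans (cong (λ t → x ++ t ++ y) (trans (sym e) (window-cong u (nth (φⁿ𝟎 N)) i (length w) agree))) e′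
    where
    N : ℕ
    N = i + length w
    agree : ∀ j → j < N → u j ≡ nth (φⁿ𝟎 N) j
    agree j j< = uβ≡nth-φⁿ𝟎 N j (<-≤-trans j< (<⇒≤ (φⁿ𝟎-length N)))

  Factor⇒IsInfix-φ : ∀ w → Factor u w → ∃ λ n → IsInfix w (Φ (φⁿ𝟎 n))
  Factor⇒IsInfix-φ w f with Factor⇒IsInfix w f
  ... | n , inf = n , IsInfix-trans inf (IsPrefix⇒IsInfix (φⁿ𝟎-IsPrefix-suc n))

  Factor-IsInfix-closed : ∀ {v w} → IsInfix v w → Factor u w → Factor u v
  Factor-IsInfix-closed {v} {w} v⊑w f with Factor⇒IsInfix w f
  ... | n , inf = IsInfix⇒Factor n v (IsInfix-trans v⊑w inf)

  Factor-φ : ∀ w → Factor u w → Factor u (Φ w)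
  Factor-φ w f with Factor⇒IsInfix w f
  ... | n , inf = IsInfix⇒Factor (suc n) (Φ w) (φ-IsInfix inf)

  Factor-extendable : ∀ w → Factor u w → ∃₂ λ c d → Factor u (c ∷ w ++ d ∷ [])
  Factor-extendable w f with Factor⇒IsInfix w f
  ... | n , inf with φⁿ𝟎-inner n
  ...   | l , r , e with IsInfix-strict-extend 𝟎 l 𝟎 r inf e
  ...     | c , d , inf′ = c , d , IsInfix⇒Factor (suc (suc n)) (c ∷ w ++ d ∷ []) inf′

  -- Here and below factors are destructured with let: with-abstraction over such goals can make
  -- the type checker unfold the fixed point uβ without bound.
  T-preserves-extensions : ∀ w a b → Factor u (a ∷ w ++ b ∷ []) ⇔ Factor u (a ∷ T p q w ++ b ∷ [])
  T-preserves-extensions w a b = mk⇔ to from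
    where
    to : Factor u (a ∷ w ++ b ∷ []) → Factor u (a ∷ T p q w ++ b ∷ [])
    to f =
      let c , d , f′ = Factor-extendable (a ∷ w ++ b ∷ []) f
      in Factor-IsInfix-closed {a ∷ T p q w ++ b ∷ []} (T-IsInfix-φ c a w b)
           (Factor-φ (c ∷ a ∷ w ++ b ∷ []) (Factor-IsInfix-closed {c ∷ a ∷ w ++ b ∷ []} ([] , d ∷ [] , refl) f′))
    from : Factor u (a ∷ T p q w ++ b ∷ []) → Factor u (a ∷ w ++ b ∷ [])
    from f = let n , inf = Factor⇒IsInfix-φ (a ∷ T p q w ++ b ∷ []) f
             in IsInfix⇒Factor n (a ∷ w ++ b ∷ []) (T-desubstitution (φⁿ𝟎 n) a w b inf)

  T-preserves-factors : ∀ w → Factor u w → Factor u (T p q w)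
  T-preserves-factors w f =
    let c , d , f′ = Factor-extendable w f
    in Factor-IsInfix-closed {T p q w} (c ∷ [] , d ∷ [] , refl) (Equivalence.to (T-preserves-extensions w c d) f′)

  φ≡++𝟏⇒T≡ : ∀ w m → Φ w ≡ m ++ 𝟏 ∷ [] → T p q w ≡ zeros q ++ 𝟏 ∷ m ++ 𝟏 ∷ zeros q
  φ≡++𝟏⇒T≡ w m e = cong (λ t → zeros q ++ 𝟏 ∷ t) (trans (cong (_++ zeros q) e) (++-assoc m (𝟏 ∷ []) (zeros q)))

  left-special-first-block : ∀ v j r → v ≡ zeros j ++ 𝟏 ∷ r → LeftSpecial u v → j ≡ q
  left-special-first-block v j r refl (f₀ , f₁)
    with Factor⇒IsInfix-φ (𝟎 ∷ v) f₀ | Factor⇒IsInfix-φ (𝟏 ∷ v) f₁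
  ... | n₀ , inf₀ | n₁ , inf₁
    with zeros-between-𝟏s (φⁿ𝟎 n₁) j (IsInfix-trans (IsPrefix⇒IsInfix (IsPrefix-++-∷ (𝟏 ∷ zeros j) 𝟏 r)) inf₁)
  ... | 𝟏 , j≡q  = j≡q
  ... | 𝟎 , refl = ⊥-elim (no-long-zero-run (φⁿ𝟎 n₀)
                     (IsInfix-trans (IsPrefix⇒IsInfix (IsPrefix-++-∷ (𝟎 ∷ zeros p) 𝟏 r)) inf₀))

  right-special-last-block : ∀ v r j → v ≡ r ++ 𝟏 ∷ zeros j → RightSpecial u v → j ≡ q
  right-special-last-block v r j refl (f₀ , f₁)
    with Factor⇒IsInfix-φ (v ++ 𝟎 ∷ []) f₀ | Factor⇒IsInfix-φ (v ++ 𝟏 ∷ []) f₁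
  ... | n₀ , inf₀ | n₁ , inf₁
    with zeros-between-𝟏s (φⁿ𝟎 n₁) j (IsInfix-trans (IsSuffix⇒IsInfix (IsSuffix-++-∷ r (𝟏 ∷ zeros j) 𝟏)) inf₁)
  ... | 𝟏 , j≡q  = j≡q
  ... | 𝟎 , refl with zeros-after-𝟏 (φⁿ𝟎 n₀) p (IsInfix-trans (IsSuffix⇒IsInfix (IsSuffix-++-∷ r (𝟏 ∷ zeros p) 𝟎)) inf₀)
  ...   | d , p<d = ⊥-elim (<-irrefl refl (<-≤-trans p<d (blockLength≤p d)))

  desubstitute-between-𝟏s : ∀ m → Factor u (𝟏 ∷ m ++ 𝟏 ∷ []) → ∃ λ w → Factor u w × Φ w ≡ m ++ 𝟏 ∷ []
  desubstitute-between-𝟏s m f =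
    let n , inf = Factor⇒IsInfix-φ (𝟏 ∷ m ++ 𝟏 ∷ []) f
        w , w⊑ , Φw≡ = φ-between-𝟏s (φⁿ𝟎 n) m inf
    in w , IsInfix⇒Factor n w w⊑ , Φw≡

  bispecial-shape : ∀ v → Bispecial u v → 𝟏 ∈ v →
                    v ≡ T p q [] ⊎ ∃ λ m → v ≡ zeros q ++ 𝟏 ∷ m ++ 𝟏 ∷ zeros q
  bispecial-shape v (ls , rs) 𝟏∈ with first-𝟏 v 𝟏∈ | last-𝟏 v 𝟏∈
  ... | j , r , ev | r′ , j′ , ev′
    with left-special-first-block v j r ev ls | right-special-last-block v r′ j′ ev′ rs
  ... | refl | refl with block-split q r r′ (zeros q) (trans (sym ev) ev′)
  ... | inj₁ (_ , r≡)      = inj₁ (trans ev (cong (λ t → zeros q ++ 𝟏 ∷ t) r≡))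
  ... | inj₂ (m , _ , refl) = inj₂ (m , ev)

  bispecial-T-form : ∀ v → Factor u v → Bispecial u v → 𝟏 ∈ v → ∃ λ w → Factor u w × v ≡ T p q w
  bispecial-T-form v f b 𝟏∈ = from-shape (bispecial-shape v b 𝟏∈)
    where
    from-shape : v ≡ T p q [] ⊎ (∃ λ m → v ≡ zeros q ++ 𝟏 ∷ m ++ 𝟏 ∷ zeros q) → ∃ λ w → Factor u w × v ≡ T p q w
    from-shape (inj₁ v≡) = [] , (0 , refl) , v≡
    from-shape (inj₂ (m , v≡)) =
      let w , fw , Φw≡ = desubstitute-between-𝟏s m (Factor-IsInfix-closed {𝟏 ∷ m ++ 𝟏 ∷ []} (zeros q , zeros q , inner) f)
      in w , fw , trans v≡ (sym (φ≡++𝟏⇒T≡ w m Φw≡))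
      where
      inner : zeros q ++ (𝟏 ∷ m ++ 𝟏 ∷ []) ++ zeros q ≡ v
      inner = trans (cong (λ t → zeros q ++ 𝟏 ∷ t) (++-assoc m (𝟏 ∷ []) (zeros q))) (sym v≡)

  bispecial-unique-T-form : ∀ v → Factor u v → Bispecial u v → 𝟏 ∈ v →
    Σ Word λ w → (Factor u w × v ≡ T p q w) × (∀ w′ → Factor u w′ → v ≡ T p q w′ → w′ ≡ w)
  bispecial-unique-T-form v f b 𝟏∈ =
    let w , fw , v≡Tw = bispecial-T-form v f b 𝟏∈
    in w , (fw , v≡Tw) , λ w′ _ v≡Tw′ → T-injective w′ w (trans (sym v≡Tw′) v≡Tw)

  IsPrefix⇒T-IsPrefix : ∀ w v → IsPrefix w v → IsPrefix (T p q w) (T p q v)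
  IsPrefix⇒T-IsPrefix w v ([] , e) = [] , trans (++-identityʳ _) (cong (T p q) (trans (sym (++-identityʳ w)) e))
  IsPrefix⇒T-IsPrefix w v (c ∷ s , refl) with φ-letter-starts c
  ... | R , eR = c ∷ R ++ Φ s ++ zeros q , (begin
    T p q w ++ c ∷ R ++ Φ s ++ zeros q
      ≡⟨ solve 6 (λ Zq i Φw c R Φs → (Zq ⊕ i ⊕ (Φw ⊕ Zq)) ⊕ (c ⊕ (R ⊕ Φs ⊕ Zq)) ⊜ Zq ⊕ i ⊕ ((Φw ⊕ ((Zq ⊕ c ⊕ R) ⊕ Φs)) ⊕ Zq))
                 refl (zeros q) (𝟏 ∷ []) (Φ w) (c ∷ []) R (Φ s) ⟩
    zeros q ++ 𝟏 ∷ (Φ w ++ (zeros q ++ c ∷ R) ++ Φ s) ++ zeros q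
      ≡⟨ cong (λ t → zeros q ++ 𝟏 ∷ (Φ w ++ t ++ Φ s) ++ zeros q) (sym eR) ⟩
    zeros q ++ 𝟏 ∷ (Φ w ++ Φ (c ∷ s)) ++ zeros q
      ≡⟨ cong (λ t → zeros q ++ 𝟏 ∷ t ++ zeros q) (sym (φ-++ w (c ∷ s))) ⟩
    T p q (w ++ c ∷ s) ∎)
    where open ≡-Reasoning

  T-IsPrefix⇒IsPrefix : ∀ w v → IsPrefix (T p q w) (T p q v) → IsPrefix w v
  T-IsPrefix⇒IsPrefix []      v _       = v , refl
  T-IsPrefix⇒IsPrefix (c ∷ w) v (S , e) with φ-∷-ends-𝟏 c w
  ... | s , es with 𝟏-lies-before-zeros s (zeros q ++ S) (Φ v) q (trans regroup (trans (cong (λ t → (t ++ zeros q) ++ S) (sym es)) e′))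
    where
    e′ : (Φ (c ∷ w) ++ zeros q) ++ S ≡ Φ v ++ zeros q
    e′ = ∷-injectiveʳ (++-cancelˡ (zeros q) _ _ (trans (sym (++-assoc (zeros q) _ S)) e))
    regroup : s ++ 𝟏 ∷ zeros q ++ S ≡ ((s ++ 𝟏 ∷ []) ++ zeros q) ++ S
    regroup = solve 4 (λ s i Zq S → s ⊕ i ⊕ (Zq ⊕ S) ⊜ ((s ⊕ i) ⊕ Zq) ⊕ S) refl s (𝟏 ∷ []) (zeros q) S
  ...   | t , et with φ-prefix-cancel (c ∷ w) v t (trans (cong (_++ t) es) (trans (++-assoc s (𝟏 ∷ []) t) et))
  ...     | s′ , v≡ , _ = s′ , sym v≡

  IsSuffix⇒T-IsSuffix : ∀ w v → IsSuffix w v → IsSuffix (T p q w) (T p q v)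
  IsSuffix⇒T-IsSuffix w v ([] , e) = [] , cong (T p q) e
  IsSuffix⇒T-IsSuffix w v (c ∷ s , refl) with φ-∷-ends c s
  ... | s₀ , es = zeros q ++ 𝟏 ∷ s₀ , (begin
    (zeros q ++ 𝟏 ∷ s₀) ++ T p q w
      ≡⟨ solve 4 (λ Zq i s₀ Φw → (Zq ⊕ i ⊕ s₀) ⊕ (Zq ⊕ i ⊕ (Φw ⊕ Zq)) ⊜ Zq ⊕ i ⊕ ((s₀ ⊕ Zq ⊕ i) ⊕ Φw) ⊕ Zq)
                 refl (zeros q) (𝟏 ∷ []) s₀ (Φ w) ⟩
    zeros q ++ 𝟏 ∷ ((s₀ ++ zeros q ++ 𝟏 ∷ []) ++ Φ w) ++ zeros q
      ≡⟨ cong (λ t → zeros q ++ 𝟏 ∷ (t ++ Φ w) ++ zeros q) (sym es) ⟩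
    zeros q ++ 𝟏 ∷ (Φ (c ∷ s) ++ Φ w) ++ zeros q
      ≡⟨ cong (λ t → zeros q ++ 𝟏 ∷ t ++ zeros q) (sym (φ-++ (c ∷ s) w)) ⟩
    T p q (c ∷ s ++ w) ∎)
    where open ≡-Reasoning

  T-IsSuffix⇒IsSuffix : ∀ w v → IsSuffix (T p q w) (T p q v) → IsSuffix w v
  T-IsSuffix⇒IsSuffix w v (S , e) with block-split q (Φ v) (S ++ zeros q) (Φ w) (sym (++-cancelʳ (zeros q) _ _ regroup))
    where
    regroup : ((S ++ zeros q) ++ 𝟏 ∷ Φ w) ++ zeros q ≡ (zeros q ++ 𝟏 ∷ Φ v) ++ zeros q
    regroup = begin
      ((S ++ zeros q) ++ 𝟏 ∷ Φ w) ++ zeros q ≡⟨ solve 4 (λ S Zq i Φw → ((S ⊕ Zq) ⊕ i ⊕ Φw) ⊕ Zq ⊜ S ⊕ (Zq ⊕ i ⊕ (Φw ⊕ Zq)))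
                                                        refl S (zeros q) (𝟏 ∷ []) (Φ w) ⟩
      S ++ T p q w                           ≡⟨ e ⟩
      T p q v                                ≡⟨ sym (++-assoc (zeros q) (𝟏 ∷ Φ v) (zeros q)) ⟩
      (zeros q ++ 𝟏 ∷ Φ v) ++ zeros q        ∎
      where open ≡-Reasoning
  ... | inj₁ (_ , Φv≡Φw) = [] , φ-injective w v (sym Φv≡Φw)
  ... | inj₂ (x′ , _ , ex) with φ-split-at-𝟏 v x′ (Φ w) ex
  ...   | z₁ , c , z₂ , refl , _ , Φw≡ with φ-injective w z₂ Φw≡
  ...     | refl = z₁ ++ c ∷ [] , ++-assoc z₁ (c ∷ []) w

mainTheorem1 : (p q : ℕ) → q < p → 1 ≤ q →
    ((w : Word) → Factor (uβ p q) w → Factor (uβ p q) (T p q w))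
    × ((w : Word) → Factor (uβ p q) w → (a b : Letter) →
        Factor (uβ p q) (a ∷ w ++ b ∷ []) ⇔ Factor (uβ p q) (a ∷ T p q w ++ b ∷ []))
    × ((v : Word) → Factor (uβ p q) v → Bispecial (uβ p q) v → 𝟏 ∈ v →
        Σ Word λ w → (Factor (uβ p q) w × v ≡ T p q w)
          × ((w′ : Word) → Factor (uβ p q) w′ → v ≡ T p q w′ → w′ ≡ w))
    × ((w v : Word) → Factor (uβ p q) w → Factor (uβ p q) v →
        IsPrefix w v ⇔ IsPrefix (T p q w) (T p q v))
    × ((w v : Word) → Factor (uβ p q) w → Factor (uβ p q) v →
        IsSuffix w v ⇔ IsSuffix (T p q w) (T p q v))
mainTheorem1 p (suc q′) q<p (s≤s z≤n) with m≤n⇒∃[o]m+o≡n q<p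
... | k , refl =
    T-preserves-factors
  , (λ w _ → T-preserves-extensions w)
  , bispecial-unique-T-form
  , (λ w v _ _ → mk⇔ (IsPrefix⇒T-IsPrefix w v) (T-IsPrefix⇒IsPrefix w v))
  , (λ w v _ _ → mk⇔ (IsSuffix⇒T-IsSuffix w v) (T-IsSuffix⇒IsSuffix w v))
  where open FixedPoint q′ k
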